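{- Let $q$ be a power of $2$, $v\ge1$, and let $K=\{(a_1,a_1^2,a_2,a_2^2,\dots,a_v,a_v^2): a_1,\dots,a_v\in\mathbb{F}_q\}\subset AG(2v,q)$ and $A=AG(2v,q)\setminus K$. Then through every point of $A$ there pass exactly $B_{q,v}-q^v+\frac{q-2}{2}$ lines of $AG(2v,q)$ that are entirely contained in $A$, where $B_{q,v}=\frac{q^{2v}-1}{q-1}$.
   Context: $AG(2v,q)$ is the affine space of dimension $2v$ over $\mathbb{F}_q$, whose points are the vectors of $\mathbb{F}_q^{2v}$ and whose lines are the cosets of $1$-dimensional subspaces; $B_{q,v}$ is the number of lines through a point. -}

module Defs where

open import Level using (0ℓ)
open import Data.Nat using (ℕ; zero; suc; _∸_; _^_; _/_)
open import Data.Product using (Σ; ∃; _×_; _,_)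
open import Data.Sum using (_⊎_)
open import Data.Empty using (⊥)
open import Data.List using (List; length)
open import Data.List.Membership.Propositional using (_∈_)
open import Data.List.Relation.Unary.Unique.Propositional using (Unique)
open import Data.Vec using (Vec; []; _∷_; zipWith; map)
open import Function.Bundles using (_⇔_)
open import Relation.Nullary using (¬_)
open import Relation.Binary.PropositionalEquality using (_≡_)
open import Relation.Binary.Definitions using (DecidableEquality)
open import Algebra.Core using (Op₁; Op₂)
open import Algebra.Structures using (IsCommutativeRing)

record Field : Set₁ where
  infixl 6 _+_
  infixl 7 _*_
  field
    Carrier : Set
    _+_ _*_ : Op₂ Carrier
    -_      : Op₁ Carrier
    0# 1#   : Carrier
    isCommutativeRing : IsCommutativeRing _≡_ _+_ _*_ -_ 0# 1#
    0≢1     : ¬ (0# ≡ 1#)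
    inverse : ∀ x → ¬ (x ≡ 0#) → ∃ λ y → x * y ≡ 1#
    _≟_     : DecidableEquality Carrier

HasSize : {A : Set} → (A → Set) → ℕ → Set
HasSize {A} P n = Σ (List A) λ L → Unique L × (∀ a → (a ∈ L) ⇔ P a) × (length L ≡ n)

-- dbl n = 2n, defined so that Vec C (dbl (suc n)) = Vec C (suc (suc (dbl n))) definitionally
dbl : ℕ → ℕ
dbl zero = zero
dbl (suc n) = suc (suc (dbl n))

-- B_{q,v} = (q^{2v} - 1)/(q - 1), for q ≥ 2 (value irrelevant for q < 2)
B : ℕ → ℕ → ℕ
B zero v = 0
B (suc zero) v = 0
B (suc (suc k)) v = ((suc (suc k)) ^ dbl v ∸ 1) / suc k

module _ (F : Field) where
  open Field F

  Point : ℕ → Set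
  Point v = Vec Carrier (dbl v)

  embedK : ∀ {v} → Vec Carrier v → Point v
  embedK [] = []
  embedK (a ∷ as) = a ∷ (a * a) ∷ embedK as

  InK : ∀ {v} → Point v → Set
  InK {v} y = ∃ λ (a : Vec Carrier v) → y ≡ embedK a

  InA : ∀ {v} → Point v → Set
  InA y = ¬ InK y

  _+ᵥ_ : ∀ {n} → Vec Carrier n → Vec Carrier n → Vec Carrier n
  _+ᵥ_ = zipWith _+_

  _·_ : ∀ {n} → Carrier → Vec Carrier n → Vec Carrier n
  t · d = map (t *_) d

  -- canonical direction vector of a line: nonzero, first nonzero coordinate equal to 1.
  -- Every 1-dimensional subspace has exactly one such generator, so the lines through
  -- a point x correspond bijectively to the normalized vectors d (line = {x + t d}).
  Normalized : ∀ {n} → Vec Carrier n → Set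
  Normalized [] = ⊥
  Normalized (c ∷ cs) = (c ≡ 1#) ⊎ ((c ≡ 0#) × Normalized cs)

  LineInA : ∀ {v} → Point v → Point v → Set
  LineInA x d = ∀ t → InA (x +ᵥ (t · d))

-- The q - 1 nonzero elements of F are odd in number, so a ↦ -a cannot pair them off: F has
-- characteristic 2, squaring is additive and injective, and hence bijective on the finite F.
-- Lines through x = (x₁, y₁, …, x_v, y_v) ∉ K correspond to normalized directions.  The line from
-- x through a point (a₁, a₁², …) of K meets K again at parameter c ∉ {0, 1} iff
-- c (aᵢ + xᵢ)² = xᵢ² + yᵢ for all i.  For each such c exactly one a solves this (coordinatewise
-- square roots), and no a solves it for two values of c, as that would put x in K.  So every line
-- through x meets K at most twice, and seen from the second point the parameter of the first is
-- c⁻¹.  Choosing one element of each pair {c, c⁻¹}, the q - 2 points of K that lie on two-point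
-- lines account for (q - 2)/2 lines, so exactly q^v - (q - 2)/2 of the B_{q,v} lines through x meet K.

module Submission where

open import Defs
open import Level using (0ℓ)
open import Data.Empty using (⊥; ⊥-elim)
open import Data.Unit using (⊤; tt)
open import Data.Nat as ℕ using (ℕ; zero; suc)
open import Data.Nat.Properties using (even≢odd)
open import Data.Product using (Σ; ∃; ∃₂; _×_; _,_; proj₁; proj₂)
open import Data.Product.Function.NonDependent.Propositional using (_×-⇔_)
open import Data.Sum using (_⊎_; inj₁; inj₂)
open import Data.List using (List; []; _∷_; length; map; _++_; filter; cartesianProductWith)
open import Data.List.Properties using (length-++; length-map)
open import Data.List.Membership.Propositional using (_∈_; _∉_)
open import Data.List.Membership.Propositional.Properties
  using (∈-++⁻; ∈-++⁺ˡ; ∈-++⁺ʳ; ∈-map⁺; ∈-map⁻; ∈-filter⁺; ∈-filter⁻; ∈-cartesianProductWith⁺)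
open import Data.List.Membership.Propositional.Properties.WithK using (unique∧set⇒bag)
open import Data.List.Relation.Binary.BagAndSetEquality using (∼bag⇒↭)
open import Data.List.Relation.Binary.Permutation.Propositional.Properties using (↭-length)
open import Data.List.Relation.Unary.Unique.Propositional using (Unique)
import Data.List.Relation.Unary.Unique.Propositional.Properties as Unique
import Data.List.Relation.Unary.All as All
import Data.List.Relation.Unary.All.Properties as All
open import Data.List.Relation.Unary.AllPairs using ([]; _∷_)
open import Data.List.Relation.Unary.Any using (here; there; any?; satisfied)
import Data.List.Relation.Unary.Any as Any
open import Data.Vec using (Vec; []; _∷_; head; tail)
open import Data.Vec.Properties using (∷-injective; ∷-injectiveʳ; map-∘; map-cong; map-id)
open import Function using (_∘_)
open import Function.Bundles using (_⇔_; mk⇔; Equivalence)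
open import Relation.Nullary using (¬_; Dec; yes; no)
import Relation.Nullary.Decidable as Dec
open import Relation.Unary using (Pred; U; Empty; Decidable; _∩_; _∪_; _∖_; _≐_)
open import Relation.Unary.Properties using (∁?)
open import Relation.Binary.Definitions using (DecidableEquality)
open import Relation.Binary.PropositionalEquality
  using (_≡_; _≢_; refl; sym; trans; cong; cong₂; subst; module ≡-Reasoning)
open import Algebra.Bundles using (CommutativeRing)
open import Algebra.Structures using (IsCommutativeRing)

open Equivalence using (to; from)

private
  variable
    A A′ C : Set
    P Q : Pred A _
    k m n q : ℕ

module FiniteSets where

  open import Data.Nat using (_+_; _*_; _∸_; _^_)
  open import Data.Nat.Properties using (+-suc; *-suc; m+n∸m≡n; n∸n≡0)

  HasSize-unique : HasSize P m → HasSize P n → m ≡ n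
  HasSize-unique (L₁ , L₁! , L₁⇔ , refl) (L₂ , L₂! , L₂⇔ , refl) =
    ↭-length (∼bag⇒↭ (unique∧set⇒bag L₁! L₂! (λ {a} →
      mk⇔ (from (L₂⇔ a) ∘ to (L₁⇔ a)) (from (L₁⇔ a) ∘ to (L₂⇔ a)))))

  HasSize-cong : P ≐ Q → HasSize P n → HasSize Q n
  HasSize-cong (P⊆Q , Q⊆P) (L , L! , L⇔ , ∣L∣) =
    L , L! , (λ a → mk⇔ (P⊆Q ∘ to (L⇔ a)) (from (L⇔ a) ∘ Q⊆P)) , ∣L∣

  HasSize-∅ : Empty P → HasSize P 0
  HasSize-∅ ∅ = [] , [] , (λ a → mk⇔ (λ ()) (⊥-elim ∘ ∅ a)) , refl

  HasSize-0⇒Empty : HasSize P 0 → Empty P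
  HasSize-0⇒Empty ([] , _ , L⇔ , _) a pa with () ← from (L⇔ a) pa

  HasSize-∈ : {L : List A} → Unique L → HasSize (_∈ L) (length L)
  HasSize-∈ {L = L} L! = L , L! , (λ a → mk⇔ (λ a∈L → a∈L) (λ a∈L → a∈L)) , refl

  HasSize-∪ : (∀ {a} → P a → Q a → ⊥) → HasSize P m → HasSize Q n → HasSize (P ∪ Q) (m + n)
  HasSize-∪ {P = P} {Q = Q} disjoint (L₁ , L₁! , L₁⇔ , refl) (L₂ , L₂! , L₂⇔ , refl) =
    L₁ ++ L₂ ,
    Unique.++⁺ L₁! L₂! (λ (a∈L₁ , a∈L₂) → disjoint (to (L₁⇔ _) a∈L₁) (to (L₂⇔ _) a∈L₂)) ,
    (λ a → mk⇔ (split a) (join a)) , length-++ L₁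
    where
    split : ∀ a → a ∈ L₁ ++ L₂ → (P ∪ Q) a
    split a a∈ with ∈-++⁻ L₁ a∈
    ... | inj₁ a∈L₁ = inj₁ (to (L₁⇔ a) a∈L₁)
    ... | inj₂ a∈L₂ = inj₂ (to (L₂⇔ a) a∈L₂)
    join : ∀ a → (P ∪ Q) a → a ∈ L₁ ++ L₂
    join a (inj₁ pa) = ∈-++⁺ˡ (from (L₁⇔ a) pa)
    join a (inj₂ qa) = ∈-++⁺ʳ L₁ (from (L₂⇔ a) qa)

  length-filter-∁ : (Q? : Decidable Q) (L : List A) →
    length (filter Q? L) + length (filter (∁? Q?) L) ≡ length L
  length-filter-∁ Q? [] = refl
  length-filter-∁ Q? (a ∷ L) with Q? a
  ... | yes _ = cong suc (length-filter-∁ Q? L)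
  ... | no  _ = trans (+-suc _ _) (cong suc (length-filter-∁ Q? L))

  HasSize-partition : Decidable Q → HasSize P n →
    ∃₂ λ k l → HasSize (P ∩ Q) k × HasSize (P ∖ Q) l × k + l ≡ n
  HasSize-partition {Q = Q} {P = P} Q? (L , L! , L⇔ , refl) =
    _ , _ , restrict Q? , restrict (∁? Q?) , length-filter-∁ Q? L
    where
    restrict : {R : Pred _ _} (R? : Decidable R) → HasSize (P ∩ R) (length (filter R? L))
    restrict R? = filter R? L , Unique.filter⁺ R? L! ,
      (λ a → mk⇔ (λ a∈ → let a∈L , ra = ∈-filter⁻ R? a∈ in to (L⇔ a) a∈L , ra)
                 (λ (pa , ra) → ∈-filter⁺ R? (from (L⇔ a) pa) ra)) ,
      refl

  HasSize-∖ : Decidable Q → HasSize P n → HasSize (P ∩ Q) k → HasSize (P ∖ Q) (n ∸ k)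
  HasSize-∖ Q? P-size P∩Q-size with HasSize-partition Q? P-size
  ... | k , l , P∩Q-size′ , P∖Q-size , refl
    rewrite HasSize-unique P∩Q-size P∩Q-size′ | m+n∸m≡n k l = P∖Q-size

  HasSize-∉ : DecidableEquality A → HasSize (U {A = A}) n → {L : List A} → Unique L → HasSize (_∉ L) (n ∸ length L)
  HasSize-∉ _≟_ A-size {L} L! =
    HasSize-cong (proj₂ , (tt ,_)) (HasSize-∖ (_∈? L) A-size (HasSize-cong ((tt ,_) , proj₂) (HasSize-∈ L!)))
    where open import Data.List.Membership.DecPropositional _≟_ using (_∈?_)

  HasSize-map : (f : A → A′) → (∀ {a b} → P a → P b → f a ≡ f b → a ≡ b) → (∀ {a} → P a → Q (f a)) →
    (∀ {b} → Q b → ∃ λ a → P a × f a ≡ b) → HasSize P n → HasSize Q n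
  HasSize-map {P = P} {Q = Q} f f-inj P⇒Q Q⇒P (L , L! , L⇔ , refl) =
    map f L , map-unique (All.tabulate (λ {a} → to (L⇔ a))) L! , (λ b → mk⇔ (in-image b) (∈-image b)) , length-map f L
    where
    map-unique : ∀ {L} → All.All P L → Unique L → Unique (map f L)
    map-unique All.[] [] = []
    map-unique (pa All.∷ pL) (a∉L ∷ L!) =
      All.map⁺ (All.zipWith (λ (pb , a≢b) fa≡fb → a≢b (f-inj pa pb fa≡fb)) (pL , a∉L)) ∷ map-unique pL L!
    in-image : ∀ b → b ∈ map f L → Q b
    in-image b b∈ with ∈-map⁻ f b∈
    ... | a , a∈L , refl = P⇒Q (to (L⇔ a) a∈L)
    ∈-image : ∀ b → Q b → b ∈ map f L
    ∈-image b qb with Q⇒P qb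
    ... | a , pa , refl = ∈-map⁺ f (from (L⇔ a) pa)

  length-cartesianProductWith : (f : A → A′ → C) (L : List A) (L′ : List A′) →
    length (cartesianProductWith f L L′) ≡ length L * length L′
  length-cartesianProductWith f [] L′ = refl
  length-cartesianProductWith f (a ∷ L) L′ = begin
    length (map (f a) L′ ++ cartesianProductWith f L L′)  ≡⟨ length-++ (map (f a) L′) ⟩
    length (map (f a) L′) + length (cartesianProductWith f L L′)
      ≡⟨ cong₂ _+_ (length-map (f a) L′) (length-cartesianProductWith f L L′) ⟩
    length L′ + length L * length L′  ∎
    where open ≡-Reasoning

  HasSize-Vec : HasSize (U {A = A}) q → ∀ n → HasSize (U {A = Vec A n}) (q ^ n)
  HasSize-Vec A-size zero = [] ∷ [] , All.[] ∷ [] , (λ { [] → mk⇔ _ (λ _ → here refl) }) , refl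
  HasSize-Vec A-size@(L , L! , L⇔ , refl) (suc n) with HasSize-Vec A-size n
  ... | L′ , L′! , L′⇔ , ∣L′∣ =
    cartesianProductWith _∷_ L L′ ,
    Unique.cartesianProductWith⁺ _∷_ ∷-injective L! L′! ,
    (λ { (a ∷ as) → mk⇔ _ (λ _ → ∈-cartesianProductWith⁺ _∷_ (from (L⇔ a) tt) (from (L′⇔ as) tt)) }) ,
    trans (length-cartesianProductWith _∷_ L L′) (cong (length L *_) ∣L′∣)

  finite-∃? : {P : A → Set} → HasSize (U {A = A}) q → Decidable P → Dec (∃ P)
  finite-∃? (L , _ , L⇔ , _) P? =
    Dec.map′ satisfied (λ (a , pa) → Any.map (λ { refl → pa }) (from (L⇔ a) tt)) (any? P? L)

  finite-injective⇒surjective : DecidableEquality A → HasSize (U {A = A}) q →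
    (f : A → A) → (∀ {a b} → f a ≡ f b → a ≡ b) → ∀ b → ∃ λ a → f a ≡ b
  finite-injective⇒surjective {q = q} _≟_ A-size f f-inj b with finite-∃? A-size (λ a → f a ≟ b)
  ... | yes b∈image = b∈image
  ... | no b∉image = ⊥-elim (HasSize-0⇒Empty coimage-size b (tt , b∉image))
    where
    Image : Pred _ _
    Image b = ∃ λ a → f a ≡ b
    image-size : HasSize (U ∩ Image) q
    image-size = HasSize-map f (λ _ _ → f-inj) (λ {a} _ → tt , a , refl) (λ { (_ , a , refl) → a , tt , refl }) A-size
    coimage-size : HasSize (U ∖ Image) 0
    coimage-size = subst (HasSize _) (n∸n≡0 q)
      (HasSize-∖ (λ b → finite-∃? A-size (λ a → f a ≟ b)) A-size image-size)

  FixedPointFreeInvolution : Pred A 0ℓ → (A → A) → Set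
  FixedPointFreeInvolution P ι = ∀ {a} → P a → P (ι a) × ι (ι a) ≡ a × ι a ≢ a

  record Transversal (P : Pred A 0ℓ) (ι : A → A) : Set where
    field
      reps        : List A
      reps-unique : Unique reps
      reps⊆P      : ∀ {a} → a ∈ reps → P a
      covers      : ∀ {a} → P a → a ∈ reps ⊎ ι a ∈ reps
      separates   : ∀ {a} → a ∈ reps → ι a ∉ reps

  module _ (_≟_ : DecidableEquality A) where

    open import Data.List.Membership.DecPropositional _≟_ using (_∈?_)

    orbit : (A → A) → A → List A
    orbit ι x = x ∷ ι x ∷ []

    HasSize-∖orbit : {P : Pred A 0ℓ} {ι : A → A} {x : A} → FixedPointFreeInvolution P ι → P x → HasSize P n →
      ∃ λ l → HasSize (P ∖ (_∈ orbit ι x)) l × 2 + l ≡ n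
    HasSize-∖orbit {P = P} {ι} {x} inv px P-size with HasSize-partition (_∈? orbit ι x) P-size
    ... | k , l , P∩orbit-size , rest-size , refl =
      l , rest-size , cong (_+ l) (HasSize-unique orbit-size P∩orbit-size)
      where
      x≢ιx : x ≢ ι x
      x≢ιx x≡ιx = let _ , _ , ιx≢x = inv px in ιx≢x (sym x≡ιx)
      orbit⊆P : ∀ {a} → a ∈ orbit ι x → P a
      orbit⊆P (here refl)         = px
      orbit⊆P (there (here refl)) = proj₁ (inv px)
      orbit-size : HasSize (P ∩ (_∈ orbit ι x)) 2
      orbit-size = HasSize-cong ((λ a∈ → orbit⊆P a∈ , a∈) , proj₂)
        (HasSize-∈ ((x≢ιx All.∷ All.[]) ∷ All.[] ∷ []))

    ∖orbit-FixedPointFreeInvolution : {P : Pred A 0ℓ} {ι : A → A} {x : A} → FixedPointFreeInvolution P ι → P x →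
      FixedPointFreeInvolution (P ∖ (_∈ orbit ι x)) ι
    ∖orbit-FixedPointFreeInvolution {ι = ι} inv px {a} (pa , a∉orbit)
      with _ , ιιx≡x , _ ← inv px
      with pιa , ιιa≡a , ιa≢a ← inv pa =
      (pιa , ιa∉orbit) , ιιa≡a , ιa≢a
      where
      ιa∉orbit : ι a ∉ orbit ι _
      ιa∉orbit (here ιa≡x)          = a∉orbit (there (here (trans (sym ιιa≡a) (cong ι ιa≡x))))
      ιa∉orbit (there (here ιa≡ιx)) = a∉orbit (here (trans (sym ιιa≡a) (trans (cong ι ιa≡ιx) ιιx≡x)))

    extend-transversal : {P : Pred A 0ℓ} {ι : A → A} {x : A} → FixedPointFreeInvolution P ι → P x →
      (T : Transversal (P ∖ (_∈ orbit ι x)) ι) →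
      Σ (Transversal P ι) λ T′ → Transversal.reps T′ ≡ x ∷ Transversal.reps T
    extend-transversal {P = P} {ι} {x} inv px T = record
      { reps = x ∷ reps
      ; reps-unique = All.tabulate (λ { x∈reps refl → proj₂ (reps⊆P x∈reps) (here refl) }) ∷ reps-unique
      ; reps⊆P = λ { (here refl) → px ; (there a∈reps) → proj₁ (reps⊆P a∈reps) }
      ; covers = covers′
      ; separates = separates′ } , refl
      where
      open Transversal T
      covers′ : ∀ {a} → P a → a ∈ x ∷ reps ⊎ ι a ∈ x ∷ reps
      covers′ {a} pa with a ∈? orbit ι x
      ... | yes (here refl)         = inj₁ (here refl)
      ... | yes (there (here refl)) = inj₂ (here (proj₁ (proj₂ (inv px))))
      ... | no a∉orbit with covers (pa , a∉orbit)
      ...   | inj₁ a∈reps  = inj₁ (there a∈reps)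
      ...   | inj₂ ιa∈reps = inj₂ (there ιa∈reps)
      separates′ : ∀ {a} → a ∈ x ∷ reps → ι a ∉ x ∷ reps
      separates′ (here refl) (here ιx≡x)       = proj₂ (proj₂ (inv px)) ιx≡x
      separates′ (here refl) (there ιx∈reps)   = proj₂ (reps⊆P ιx∈reps) (there (here refl))
      separates′ (there a∈reps) (there ιa∈reps) = separates a∈reps ιa∈reps
      separates′ (there a∈reps) (here ιa≡x)
        with pa , a∉orbit ← reps⊆P a∈reps
        with _ , ιιa≡a , _ ← inv pa =
        a∉orbit (there (here (trans (sym ιιa≡a) (cong ι ιa≡x))))

    involution-transversal : {P : Pred A 0ℓ} {ι : A → A} → FixedPointFreeInvolution P ι → HasSize P n →
      Σ (Transversal P ι) λ T → n ≡ 2 * length (Transversal.reps T)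
    involution-transversal {n = zero} inv P-size = record
      { reps = [] ; reps-unique = [] ; reps⊆P = λ () ; separates = λ ()
      ; covers = λ pa → ⊥-elim (HasSize-0⇒Empty P-size _ pa) } , refl
    involution-transversal {n = suc n} inv P-size@(x ∷ _ , _ , L⇔ , _)
      with px ← to (L⇔ x) (here refl)
      with l , rest-size , refl ← HasSize-∖orbit inv px P-size
      with T , l≡2h ← involution-transversal (∖orbit-FixedPointFreeInvolution inv px) rest-size
      with T′ , refl ← extend-transversal inv px T =
      T′ , trans (cong (2 +_) l≡2h) (sym (*-suc 2 (length (Transversal.reps T))))

open FiniteSets

module Arithmetic where

  open import Data.Nat using (_+_; _*_; _∸_; _^_; _/_; _≤_; z≤n; s≤s; NonZero; pred)
  open import Data.Nat.Properties
    using (≤-trans; m≤n⇒m≤1+n; m≤m+n; m≤n+m; m≤m*n; ^-monoʳ-≤; m^n≢0; suc-pred; *-suc; *-comm; +-identityʳ;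
           m+n∸m≡n; m+n∸n≡m; m∸n+n≡m; m∸n≤m; m∸[m∸n]≡n; +-∸-assoc)
  open import Data.Nat.DivMod using (m*n/n≡m)
  open import Data.Nat.Solver using (module +-*-Solver)
  open +-*-Solver using (solve; _:=_; _:+_; _:*_; con)
  open ≡-Reasoning

  geometricSum : ℕ → ℕ → ℕ
  geometricSum q zero    = 0
  geometricSum q (suc n) = q ^ n + geometricSum q n

  geometricSum-closedForm : ∀ k n → geometricSum (suc k) n * k + 1 ≡ suc k ^ n
  geometricSum-closedForm k zero    = refl
  geometricSum-closedForm k (suc n) = begin
    (p + geometricSum (suc k) n) * k + 1
      ≡⟨ solve 3 (λ p g k → (p :+ g) :* k :+ con 1 := p :* k :+ (g :* k :+ con 1)) refl p _ k ⟩
    p * k + (geometricSum (suc k) n * k + 1) ≡⟨ cong (p * k +_) (geometricSum-closedForm k n) ⟩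
    p * k + p                              ≡⟨ solve 2 (λ p k → p :* k :+ p := (con 1 :+ k) :* p) refl p k ⟩
    suc k * p                              ∎
    where p = suc k ^ n

  B≡geometricSum : ∀ k v → B (suc (suc k)) v ≡ geometricSum (suc (suc k)) (dbl v)
  B≡geometricSum k v = begin
    (suc (suc k) ^ dbl v ∸ 1) / suc k  ≡⟨ cong (λ n → (n ∸ 1) / suc k) (sym (geometricSum-closedForm (suc k) (dbl v))) ⟩
    (G * suc k + 1 ∸ 1) / suc k        ≡⟨ cong (_/ suc k) (m+n∸n≡m (G * suc k) 1) ⟩
    G * suc k / suc k                  ≡⟨ m*n/n≡m G (suc k) ⟩
    G                                  ∎
    where G = geometricSum (suc (suc k)) (dbl v)

  n≤dbl-n : ∀ n → n ≤ dbl n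
  n≤dbl-n zero    = z≤n
  n≤dbl-n (suc n) = s≤s (m≤n⇒m≤1+n (n≤dbl-n n))

  ^≤geometricSum-dbl : ∀ q .{{_ : NonZero q}} v → q ^ suc v ≤ geometricSum q (dbl (suc v))
  ^≤geometricSum-dbl q v = ≤-trans (^-monoʳ-≤ q (s≤s (n≤dbl-n v))) (m≤m+n _ _)

  ∸-∸≡∸-+ : ∀ {n m h} → m ≤ n → h ≤ m → n ∸ (m ∸ h) ≡ n ∸ m + h
  ∸-∸≡∸-+ {n} {m} {h} m≤n h≤m = begin
    n ∸ (m ∸ h)              ≡⟨ cong (_∸ (m ∸ h)) (sym (m∸n+n≡m m≤n)) ⟩
    n ∸ m + m ∸ (m ∸ h)      ≡⟨ +-∸-assoc (n ∸ m) (m∸n≤m m h) ⟩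
    n ∸ m + (m ∸ (m ∸ h))    ≡⟨ cong (n ∸ m +_) (m∸[m∸n]≡n h≤m) ⟩
    n ∸ m + h                ∎

  2*n∸n≡n : ∀ n → 2 * n ∸ n ≡ n
  2*n∸n≡n n = trans (cong (λ m → n + m ∸ n) (+-identityʳ n)) (m+n∸m≡n n n)

  2*n/2≡n : ∀ n → 2 * n / 2 ≡ n
  2*n/2≡n n = trans (cong (_/ 2) (*-comm 2 n)) (m*n/n≡m n 2)

  2^[1+m]≡2+2*j : ∀ m → ∃ λ j → 2 ^ suc m ≡ 2 + 2 * j
  2^[1+m]≡2+2*j m = pred (2 ^ m) , trans (cong (2 *_) (sym (suc-pred (2 ^ m) {{m^n≢0 2 m}}))) (*-suc 2 _)

  lines-formula : ∀ j v → geometricSum (2 + 2 * j) (dbl (suc v)) ∸ ((2 + 2 * j) ^ suc v ∸ 2 * j / 2)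
                          ≡ B (2 + 2 * j) (suc v) ∸ (2 + 2 * j) ^ suc v + 2 * j / 2
  lines-formula j v rewrite 2*n/2≡n j | B≡geometricSum (2 * j) (suc v) =
    ∸-∸≡∸-+ (^≤geometricSum-dbl q′ v) (≤-trans j≤q′ (m≤m*n q′ (q′ ^ v) {{m^n≢0 q′ v}}))
    where
    q′ = 2 + 2 * j
    j≤q′ : j ≤ q′
    j≤q′ = ≤-trans (m≤m+n j (j + 0)) (m≤n+m _ 2)

open Arithmetic

module _ (F : Field) where

  open Field F
  open IsCommutativeRing isCommutativeRing
    using (+-comm; +-assoc; +-identityˡ; +-identityʳ; -‿inverseʳ; *-comm; *-assoc; *-identityˡ; *-identityʳ; zeroˡ; zeroʳ)

  commutativeRing : CommutativeRing 0ℓ 0ℓ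
  commutativeRing = record { isCommutativeRing = isCommutativeRing }

  open import Algebra.Solver.Ring.NaturalCoefficients.Default (CommutativeRing.commutativeSemiring commutativeRing)
    using (solve; _:=_; _:+_; _:*_; con)
  open import Algebra.Properties.Ring (CommutativeRing.ring commutativeRing) using (-‿involutive; -0#≈0#)
  open ≡-Reasoning

  infix 8 _⁻¹

  -- 0# ⁻¹ is a junk value (0#); every lemma about _⁻¹ assumes a nonzero argument.
  _⁻¹ : Carrier → Carrier
  c ⁻¹ with c ≟ 0#
  ... | yes _  = 0#
  ... | no c≢0 = proj₁ (inverse c c≢0)

  ⁻¹-inverseʳ : ∀ {c} → c ≢ 0# → c * c ⁻¹ ≡ 1#
  ⁻¹-inverseʳ {c} c≢0 with c ≟ 0#
  ... | yes c≡0  = ⊥-elim (c≢0 c≡0)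
  ... | no  c≢0′ = proj₂ (inverse c c≢0′)

  ⁻¹-inverseˡ : ∀ {c} → c ≢ 0# → c ⁻¹ * c ≡ 1#
  ⁻¹-inverseˡ {c} c≢0 = trans (*-comm (c ⁻¹) c) (⁻¹-inverseʳ c≢0)

  *-cancelˡ : ∀ {c a b} → c ≢ 0# → c * a ≡ c * b → a ≡ b
  *-cancelˡ {c} {a} {b} c≢0 ca≡cb = begin
    a                ≡⟨ sym (*-identityˡ a) ⟩
    1# * a           ≡⟨ cong (_* a) (sym (⁻¹-inverseˡ c≢0)) ⟩
    c ⁻¹ * c * a     ≡⟨ *-assoc (c ⁻¹) c a ⟩
    c ⁻¹ * (c * a)   ≡⟨ cong (c ⁻¹ *_) ca≡cb ⟩
    c ⁻¹ * (c * b)   ≡⟨ sym (*-assoc (c ⁻¹) c b) ⟩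
    c ⁻¹ * c * b     ≡⟨ cong (_* b) (⁻¹-inverseˡ c≢0) ⟩
    1# * b           ≡⟨ *-identityˡ b ⟩
    b                ∎

  no-zero-divisors : ∀ {c a} → c ≢ 0# → c * a ≡ 0# → a ≡ 0#
  no-zero-divisors {c} c≢0 ca≡0 = *-cancelˡ c≢0 (trans ca≡0 (sym (zeroʳ c)))

  *-≢0 : ∀ {a b} → a ≢ 0# → b ≢ 0# → a * b ≢ 0#
  *-≢0 a≢0 b≢0 ab≡0 = b≢0 (no-zero-divisors a≢0 ab≡0)

  ⁻¹-≢0 : ∀ {c} → c ≢ 0# → c ⁻¹ ≢ 0#
  ⁻¹-≢0 {c} c≢0 c⁻¹≡0 = 0≢1 (trans (sym (zeroʳ c)) (trans (cong (c *_) (sym c⁻¹≡0)) (⁻¹-inverseʳ c≢0)))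

  ⁻¹-involutive : ∀ {c} → c ≢ 0# → c ⁻¹ ⁻¹ ≡ c
  ⁻¹-involutive {c} c≢0 =
    *-cancelˡ (⁻¹-≢0 c≢0) (trans (⁻¹-inverseʳ (⁻¹-≢0 c≢0)) (sym (⁻¹-inverseˡ c≢0)))

  ⁻¹-≢1 : ∀ {c} → c ≢ 0# → c ≢ 1# → c ⁻¹ ≢ 1#
  ⁻¹-≢1 {c} c≢0 c≢1 c⁻¹≡1 = c≢1 (begin
    c            ≡⟨ sym (*-identityʳ c) ⟩
    c * 1#       ≡⟨ cong (c *_) (sym c⁻¹≡1) ⟩
    c * c ⁻¹     ≡⟨ ⁻¹-inverseʳ c≢0 ⟩
    1#           ∎)

  *-⁻¹-cancelˡ : ∀ {c} b → c ≢ 0# → c * (b * c ⁻¹) ≡ b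
  *-⁻¹-cancelˡ {c} b c≢0 = begin
    c * (b * c ⁻¹)   ≡⟨ solve 3 (λ b c c′ → c :* (b :* c′) := b :* (c :* c′)) refl b c (c ⁻¹) ⟩
    b * (c * c ⁻¹)   ≡⟨ cong (b *_) (⁻¹-inverseʳ c≢0) ⟩
    b * 1#           ≡⟨ *-identityʳ b ⟩
    b                ∎

  *-⁻¹-solve : ∀ {c a b} → c ≢ 0# → c * a ≡ b → a ≡ b * c ⁻¹
  *-⁻¹-solve {b = b} c≢0 ca≡b = *-cancelˡ c≢0 (trans ca≡b (sym (*-⁻¹-cancelˡ b c≢0)))

  infixl 6 _⊕_
  infixr 7 _⊙_

  _⊕_ : ∀ {n} → Vec Carrier n → Vec Carrier n → Vec Carrier n
  _⊕_ = _+ᵥ_ F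

  _⊙_ : ∀ {n} → Carrier → Vec Carrier n → Vec Carrier n
  _⊙_ = _·_ F

  0ᵥ : ∀ {n} → Vec Carrier n
  0ᵥ {zero}  = []
  0ᵥ {suc n} = 0# ∷ 0ᵥ

  ⊕-identityʳ : ∀ {n} (u : Vec Carrier n) → u ⊕ 0ᵥ ≡ u
  ⊕-identityʳ []      = refl
  ⊕-identityʳ (a ∷ u) = cong₂ _∷_ (+-identityʳ a) (⊕-identityʳ u)

  ⊕-comm : ∀ {n} (u w : Vec Carrier n) → u ⊕ w ≡ w ⊕ u
  ⊕-comm []      []      = refl
  ⊕-comm (a ∷ u) (b ∷ w) = cong₂ _∷_ (+-comm a b) (⊕-comm u w)

  ⊙-assoc : ∀ {n} s t (u : Vec Carrier n) → s ⊙ t ⊙ u ≡ (s * t) ⊙ u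
  ⊙-assoc s t u = trans (sym (map-∘ (s *_) (t *_) u)) (map-cong (λ a → sym (*-assoc s t a)) u)

  ⊙-identityˡ : ∀ {n} (u : Vec Carrier n) → 1# ⊙ u ≡ u
  ⊙-identityˡ u = trans (map-cong *-identityˡ u) (map-id u)

  ⊙-zeroˡ : ∀ {n} (u : Vec Carrier n) → 0# ⊙ u ≡ 0ᵥ
  ⊙-zeroˡ []      = refl
  ⊙-zeroˡ (a ∷ u) = cong₂ _∷_ (zeroˡ a) (⊙-zeroˡ u)

  ⊙-inverse : ∀ {n c} {u w : Vec Carrier n} → c ≢ 0# → w ≡ c ⊙ u → u ≡ c ⁻¹ ⊙ w
  ⊙-inverse {c = c} {u} {w} c≢0 w≡cu = begin
    u                 ≡⟨ sym (⊙-identityˡ u) ⟩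
    1# ⊙ u            ≡⟨ cong (_⊙ u) (sym (⁻¹-inverseˡ c≢0)) ⟩
    (c ⁻¹ * c) ⊙ u    ≡⟨ sym (⊙-assoc (c ⁻¹) c u) ⟩
    c ⁻¹ ⊙ c ⊙ u      ≡⟨ cong (c ⁻¹ ⊙_) (sym w≡cu) ⟩
    c ⁻¹ ⊙ w          ∎

  normalize : ∀ {n} → Vec Carrier n → Vec Carrier n
  normalize []      = []
  normalize (c ∷ u) with c ≟ 0#
  ... | yes _ = 0# ∷ normalize u
  ... | no  _ = 1# ∷ c ⁻¹ ⊙ u

  normalize-Normalized : ∀ {n} (u : Vec Carrier n) → u ≢ 0ᵥ → Normalized F (normalize u)
  normalize-Normalized []      u≢0 = u≢0 refl
  normalize-Normalized (c ∷ u) u≢0 with c ≟ 0#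
  ... | yes refl = inj₂ (refl , normalize-Normalized u (u≢0 ∘ cong (0# ∷_)))
  ... | no  _    = inj₁ refl

  normalize-scale : ∀ {n} (u : Vec Carrier n) → u ≢ 0ᵥ → ∃ λ l → l ≢ 0# × u ≡ l ⊙ normalize u
  normalize-scale []      u≢0 = ⊥-elim (u≢0 refl)
  normalize-scale (c ∷ u) u≢0 with c ≟ 0#
  ... | yes refl =
    let l , l≢0 , u≡ln = normalize-scale u (u≢0 ∘ cong (0# ∷_)) in
    l , l≢0 , cong₂ _∷_ (sym (zeroʳ l)) u≡ln
  ... | no c≢0 = c , c≢0 , cong₂ _∷_ (sym (*-identityʳ c)) (begin
    u                ≡⟨ sym (⊙-identityˡ u) ⟩
    1# ⊙ u           ≡⟨ cong (_⊙ u) (sym (⁻¹-inverseʳ c≢0)) ⟩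
    (c * c ⁻¹) ⊙ u   ≡⟨ sym (⊙-assoc c (c ⁻¹) u) ⟩
    c ⊙ c ⁻¹ ⊙ u     ∎)

  normalize-⊙-Normalized : ∀ {n} {d : Vec Carrier n} {t} → Normalized F d → t ≢ 0# → normalize (t ⊙ d) ≡ d
  normalize-⊙-Normalized {d = c ∷ u} {t} (inj₁ refl) t≢0 with (t * 1#) ≟ 0#
  ... | yes t1≡0 = ⊥-elim (t≢0 (trans (sym (*-identityʳ t)) t1≡0))
  ... | no  _    = cong (1# ∷_) (begin
    (t * 1#) ⁻¹ ⊙ t ⊙ u   ≡⟨ cong (λ s → s ⁻¹ ⊙ t ⊙ u) (*-identityʳ t) ⟩
    t ⁻¹ ⊙ t ⊙ u          ≡⟨ sym (⊙-inverse t≢0 refl) ⟩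
    u                     ∎)
  normalize-⊙-Normalized {d = c ∷ u} {t} (inj₂ (refl , u-normalized)) t≢0 with (t * 0#) ≟ 0#
  ... | yes _   = cong (0# ∷_) (normalize-⊙-Normalized u-normalized t≢0)
  ... | no t0≢0 = ⊥-elim (t0≢0 (zeroʳ t))

  normalize-⊙ : ∀ {n c} (u : Vec Carrier n) → c ≢ 0# → u ≢ 0ᵥ → normalize (c ⊙ u) ≡ normalize u
  normalize-⊙ {c = c} u c≢0 u≢0 with l , l≢0 , u≡ln ← normalize-scale u u≢0 = begin
    normalize (c ⊙ u)                ≡⟨ cong (normalize ∘ (c ⊙_)) u≡ln ⟩
    normalize (c ⊙ l ⊙ normalize u)  ≡⟨ cong normalize (⊙-assoc c l (normalize u)) ⟩
    normalize ((c * l) ⊙ normalize u) ≡⟨ normalize-⊙-Normalized (normalize-Normalized u u≢0) (*-≢0 c≢0 l≢0) ⟩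
    normalize u                      ∎

  normalize-≡⇒proportional : ∀ {n} {u w : Vec Carrier n} → u ≢ 0ᵥ → w ≢ 0ᵥ → normalize u ≡ normalize w →
    ∃ λ c → c ≢ 0# × w ≡ c ⊙ u
  normalize-≡⇒proportional {u = u} {w} u≢0 w≢0 same
    with l , l≢0 , u≡ln ← normalize-scale u u≢0
    with l′ , l′≢0 , w≡l′n ← normalize-scale w w≢0 = l′ * l ⁻¹ , *-≢0 l′≢0 (⁻¹-≢0 l≢0) , (begin
      w                       ≡⟨ w≡l′n ⟩
      l′ ⊙ normalize w        ≡⟨ cong (l′ ⊙_) (sym same) ⟩
      l′ ⊙ normalize u        ≡⟨ cong (l′ ⊙_) (⊙-inverse l≢0 u≡ln) ⟩
      l′ ⊙ l ⁻¹ ⊙ u           ≡⟨ ⊙-assoc l′ (l ⁻¹) u ⟩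
      (l′ * l ⁻¹) ⊙ u         ∎)

  Normalized-count : ∀ {q} → HasSize (U {A = Carrier}) q → ∀ n → HasSize (Normalized F {n}) (geometricSum q n)
  Normalized-count F-size zero = HasSize-∅ (λ { [] () })
  Normalized-count {q} F-size (suc n) =
    HasSize-cong ((λ { {_ ∷ _} p → p }) , (λ { {_ ∷ _} p → p })) by-leading-entry
    where
    leading-one : HasSize (λ (u : Vec Carrier (suc n)) → head u ≡ 1#) (q ℕ.^ n)
    leading-one = HasSize-map (1# ∷_) (λ _ _ → ∷-injectiveʳ) (λ _ → refl)
      (λ { {_ ∷ u} refl → u , tt , refl }) (HasSize-Vec F-size n)
    leading-zero : HasSize (λ (u : Vec Carrier (suc n)) → head u ≡ 0# × Normalized F (tail u)) (geometricSum q n)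
    leading-zero = HasSize-map (0# ∷_) (λ _ _ → ∷-injectiveʳ) (λ u-normalized → refl , u-normalized)
      (λ { {_ ∷ u} (refl , u-normalized) → u , u-normalized , refl }) (Normalized-count F-size n)
    disjoint : ∀ {u : Vec Carrier (suc n)} → head u ≡ 1# → head u ≡ 0# × Normalized F (tail u) → ⊥
    disjoint h≡1 (h≡0 , _) = 0≢1 (trans (sym h≡0) h≡1)
    by-leading-entry : HasSize (λ u → head u ≡ 1# ⊎ (head u ≡ 0# × Normalized F (tail u))) (q ℕ.^ n ℕ.+ geometricSum q n)
    by-leading-entry = HasSize-∪ (λ {u} → disjoint {u}) leading-one leading-zero

  embedK-injective : ∀ {v} (a b : Vec Carrier v) → embedK F a ≡ embedK F b → a ≡ b
  embedK-injective []       []       _    = refl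
  embedK-injective (a ∷ as) (b ∷ bs) same with refl , rest ← ∷-injective same =
    cong (a ∷_) (embedK-injective as bs (∷-injectiveʳ rest))

  -‿FixedPointFreeInvolution : 1# + 1# ≢ 0# → FixedPointFreeInvolution (λ a → a ≢ 0#) -_
  -‿FixedPointFreeInvolution 2≢0 {a} a≢0 = -a≢0 , -‿involutive a , -a≢a
    where
    -a≢0 : - a ≢ 0#
    -a≢0 -a≡0 = a≢0 (trans (sym (-‿involutive a)) (trans (cong -_ -a≡0) -0#≈0#))
    -a≢a : - a ≢ a
    -a≢a -a≡a = a≢0 (no-zero-divisors 2≢0 (begin
      (1# + 1#) * a  ≡⟨ solve 1 (λ a → (con 1 :+ con 1) :* a := a :+ a) refl a ⟩
      a + a          ≡⟨ cong (a +_) (sym -a≡a) ⟩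
      a + - a        ≡⟨ -‿inverseʳ a ⟩
      0#             ∎))

  odd-units⇒char2 : ∀ {k} → HasSize (λ a → a ≢ 0#) (suc (2 ℕ.* k)) → 1# + 1# ≡ 0#
  odd-units⇒char2 {k} units-size with (1# + 1#) ≟ 0#
  ... | yes 2≡0 = 2≡0
  ... | no  2≢0
    with T , odd≡even ← involution-transversal _≟_ (-‿FixedPointFreeInvolution 2≢0) units-size =
    ⊥-elim (even≢odd (length (Transversal.reps T)) k (sym odd≡even))

  OnParabolas : ∀ {v} → Point F v → Set
  OnParabolas {zero}  []          = ⊤
  OnParabolas {suc v} (x ∷ y ∷ p) = y ≡ x * x × OnParabolas p

  OnParabolas⇒InK : ∀ {v} (p : Point F v) → OnParabolas p → InK F p
  OnParabolas⇒InK {zero}  []          _                = [] , refl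
  OnParabolas⇒InK {suc v} (x ∷ y ∷ p) (refl , p-on) with as , refl ← OnParabolas⇒InK p p-on = x ∷ as , refl

  InK⇒OnParabolas : ∀ {v} (p : Point F v) → InK F p → OnParabolas p
  InK⇒OnParabolas {zero}  []          _               = tt
  InK⇒OnParabolas {suc v} (x ∷ y ∷ p) (a ∷ as , refl) = refl , InK⇒OnParabolas p (as , refl)

  OnParabolas? : ∀ {v} (p : Point F v) → Dec (OnParabolas p)
  OnParabolas? {zero}  []          = yes tt
  OnParabolas? {suc v} (x ∷ y ∷ p) = (y ≟ (x * x)) Dec.×-dec OnParabolas? p

  InK? : ∀ {v} (p : Point F v) → Dec (InK F p)
  InK? p = Dec.map′ (OnParabolas⇒InK p) (InK⇒OnParabolas p) (OnParabolas? p)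

  units-count : ∀ {q} → HasSize (U {A = Carrier}) q → HasSize (λ a → a ≢ 0#) (q ℕ.∸ 1)
  units-count F-size =
    HasSize-cong ((_∘ here) , (λ { a≢0 (here a≡0) → a≢0 a≡0 ; _ (there ()) }))
      (HasSize-∉ _≟_ F-size (All.[] ∷ []))

  Nontrivial : Carrier → Set
  Nontrivial c = c ≢ 0# × c ≢ 1#

  Nontrivial? : ∀ c → Dec (Nontrivial c)
  Nontrivial? c = Dec.¬? (c ≟ 0#) Dec.×-dec Dec.¬? (c ≟ 1#)

  Nontrivial-count : ∀ {q} → HasSize (U {A = Carrier}) q → HasSize Nontrivial (q ℕ.∸ 2)
  Nontrivial-count F-size = HasSize-cong
    ((λ c∉ → c∉ ∘ here , c∉ ∘ there ∘ here) ,
     (λ { (c≢0 , _) (here c≡0) → c≢0 c≡0 ; (_ , c≢1) (there (here c≡1)) → c≢1 c≡1 ; _ (there (there ())) }))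
    (HasSize-∉ _≟_ F-size ((0≢1 All.∷ All.[]) ∷ All.[] ∷ []))

  module _ (char2 : 1# + 1# ≡ 0#) where

    a+a≡0 : ∀ a → a + a ≡ 0#
    a+a≡0 a = begin
      a + a          ≡⟨ solve 1 (λ a → a :+ a := (con 1 :+ con 1) :* a) refl a ⟩
      (1# + 1#) * a  ≡⟨ cong (_* a) char2 ⟩
      0# * a         ≡⟨ zeroˡ a ⟩
      0#             ∎

    a+b+b≡a : ∀ a b → a + b + b ≡ a
    a+b+b≡a a b = begin
      a + b + b      ≡⟨ +-assoc a b b ⟩
      a + (b + b)    ≡⟨ cong (a +_) (a+a≡0 b) ⟩
      a + 0#         ≡⟨ +-identityʳ a ⟩
      a              ∎

    a+b≡0⇒a≡b : ∀ {a b} → a + b ≡ 0# → a ≡ b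
    a+b≡0⇒a≡b {a} {b} a+b≡0 = trans (sym (a+b+b≡a a b)) (trans (cong (_+ b) a+b≡0) (+-identityˡ b))

    a≡b⇒a+b≡0 : ∀ {a b} → a ≡ b → a + b ≡ 0#
    a≡b⇒a+b≡0 {a} refl = a+a≡0 a

    square-+ : ∀ a b → (a + b) * (a + b) ≡ a * a + b * b
    square-+ a b = begin
      (a + b) * (a + b)
        ≡⟨ solve 2 (λ a b → (a :+ b) :* (a :+ b) := a :* a :+ b :* b :+ (a :* b :+ a :* b)) refl a b ⟩
      a * a + b * b + (a * b + a * b)        ≡⟨ cong (a * a + b * b +_) (a+a≡0 (a * b)) ⟩
      a * a + b * b + 0#                     ≡⟨ +-identityʳ _ ⟩
      a * a + b * b                          ∎

    square-injective : ∀ {a b} → a * a ≡ b * b → a ≡ b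
    square-injective {a} {b} a²≡b² with (a + b) ≟ 0#
    ... | yes a+b≡0 = a+b≡0⇒a≡b a+b≡0
    ... | no  a+b≢0 = ⊥-elim (a+b≢0 (no-zero-divisors a+b≢0 (trans (square-+ a b) (a≡b⇒a+b≡0 a²≡b²))))

    -- The left-hand side says that the point with parameter c on the line from (x, y) to (a, a²)
    -- lies on the parabola Y = X² (in characteristic 2, where subtraction is addition).
    parabola-secant : ∀ {a x y c} → c ≢ 1# →
      (y + c * (a * a + y) ≡ (x + c * (a + x)) * (x + c * (a + x))) ⇔ (c * ((a + x) * (a + x)) ≡ x * x + y)
    parabola-secant {a} {x} {y} {c} c≢1 = mk⇔
      (λ on → a+b≡0⇒a≡b (no-zero-divisors c+1≢0 (trans (sym (identity)) (a≡b⇒a+b≡0 (sym on)))))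
      (λ cond → sym (a+b≡0⇒a≡b (trans identity (trans (cong ((c + 1#) *_) (a≡b⇒a+b≡0 cond)) (zeroʳ (c + 1#))))))
      where
      c+1≢0 : c + 1# ≢ 0#
      c+1≢0 = c≢1 ∘ a+b≡0⇒a≡b
      identity : (x + c * (a + x)) * (x + c * (a + x)) + (y + c * (a * a + y)) ≡
                 (c + 1#) * (c * ((a + x) * (a + x)) + (x * x + y))
      identity = solve 4 (λ a x y c →
        (x :+ c :* (a :+ x)) :* (x :+ c :* (a :+ x)) :+ (y :+ c :* (a :* a :+ y)) :=
        (c :+ con 1) :* (c :* ((a :+ x) :* (a :+ x)) :+ (x :* x :+ y))) refl a x y c

    parabola-secant-unique : ∀ {a x y c c′} →
      c * ((a + x) * (a + x)) ≡ x * x + y → c′ * ((a + x) * (a + x)) ≡ x * x + y → c ≢ c′ → y ≡ x * x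
    parabola-secant-unique {a} {x} {y} {c} {c′} cond cond′ c≢c′ = sym (a+b≡0⇒a≡b (begin
      x * x + y        ≡⟨ sym cond ⟩
      c * s            ≡⟨ cong (c *_) s≡0 ⟩
      c * 0#           ≡⟨ zeroʳ c ⟩
      0#               ∎))
      where
      s = (a + x) * (a + x)
      s≡0 : s ≡ 0#
      s≡0 = no-zero-divisors (c≢c′ ∘ a+b≡0⇒a≡b) (begin
        (c + c′) * s     ≡⟨ solve 3 (λ c c′ s → (c :+ c′) :* s := c :* s :+ c′ :* s) refl c c′ s ⟩
        c * s + c′ * s   ≡⟨ cong₂ _+_ cond cond′ ⟩
        (x * x + y) + (x * x + y) ≡⟨ a+a≡0 _ ⟩
        0#               ∎)

    SecantCondition : ∀ {v} → Point F v → Vec Carrier v → Carrier → Set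
    SecantCondition {zero}  []          []       c = ⊤
    SecantCondition {suc v} (x ∷ y ∷ p) (a ∷ as) c = c * ((a + x) * (a + x)) ≡ x * x + y × SecantCondition p as c

    secant⇔SecantCondition : ∀ {v c} (x : Point F v) (a : Vec Carrier v) → c ≢ 1# →
      OnParabolas (x ⊕ c ⊙ (embedK F a ⊕ x)) ⇔ SecantCondition x a c
    secant⇔SecantCondition {zero}  []          []       c≢1 = mk⇔ _ _
    secant⇔SecantCondition {suc v} (x ∷ y ∷ p) (a ∷ as) c≢1 = parabola-secant c≢1 ×-⇔ secant⇔SecantCondition p as c≢1

    SecantCondition-unique : ∀ {v c c′} (x : Point F v) (a : Vec Carrier v) →
      SecantCondition x a c → SecantCondition x a c′ → c ≢ c′ → OnParabolas x
    SecantCondition-unique {zero}  []          []       _              _                _     = tt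
    SecantCondition-unique {suc v} (x ∷ y ∷ p) (a ∷ as) (cond , conds) (cond′ , conds′) c≢c′ =
      parabola-secant-unique cond cond′ c≢c′ , SecantCondition-unique p as conds conds′ c≢c′

    u⊕w⊕w≡u : ∀ {n} (u w : Vec Carrier n) → u ⊕ w ⊕ w ≡ u
    u⊕w⊕w≡u []      []      = refl
    u⊕w⊕w≡u (a ∷ u) (b ∷ w) = cong₂ _∷_ (a+b+b≡a a b) (u⊕w⊕w≡u u w)

    ⊕-cancelʳ : ∀ {n} (u w x : Vec Carrier n) → u ⊕ x ≡ w ⊕ x → u ≡ w
    ⊕-cancelʳ u w x same = trans (sym (u⊕w⊕w≡u u x)) (trans (cong (_⊕ x) same) (u⊕w⊕w≡u w x))

    x⊕u≡z⇒u≡z⊕x : ∀ {n} {x u z : Vec Carrier n} → x ⊕ u ≡ z → u ≡ z ⊕ x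
    x⊕u≡z⇒u≡z⊕x {x = x} {u} refl = begin
      u            ≡⟨ sym (u⊕w⊕w≡u u x) ⟩
      u ⊕ x ⊕ x    ≡⟨ cong (_⊕ x) (⊕-comm u x) ⟩
      x ⊕ u ⊕ x    ∎

    u≡z⊕x⇒x⊕u≡z : ∀ {n} {x u z : Vec Carrier n} → u ≡ z ⊕ x → x ⊕ u ≡ z
    u≡z⊕x⇒x⊕u≡z {x = x} {z = z} refl = trans (⊕-comm x (z ⊕ x)) (u⊕w⊕w≡u z x)

    ⁻¹-FixedPointFreeInvolution : FixedPointFreeInvolution Nontrivial _⁻¹
    ⁻¹-FixedPointFreeInvolution {c} (c≢0 , c≢1) = (⁻¹-≢0 c≢0 , ⁻¹-≢1 c≢0 c≢1) , ⁻¹-involutive c≢0 , c⁻¹≢c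
      where
      c⁻¹≢c : c ⁻¹ ≢ c
      c⁻¹≢c c⁻¹≡c = c≢1 (square-injective (begin
        c * c       ≡⟨ cong (c *_) (sym c⁻¹≡c) ⟩
        c * c ⁻¹    ≡⟨ ⁻¹-inverseʳ c≢0 ⟩
        1#          ≡⟨ sym (*-identityʳ 1#) ⟩
        1# * 1#     ∎))

    module _ {q} (F-size : HasSize (U {A = Carrier}) q) where

      infix 9 √_

      √-exists : ∀ b → ∃ λ a → a * a ≡ b
      √-exists = finite-injective⇒surjective _≟_ F-size (λ a → a * a) square-injective

      √_ : Carrier → Carrier
      √ b = proj₁ (√-exists b)

      √-square : ∀ b → √ b * √ b ≡ b
      √-square b = proj₂ (√-exists b)

      secantRoot : ∀ {v} → Point F v → Carrier → Vec Carrier v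
      secantRoot {zero}  []          c = []
      secantRoot {suc v} (x ∷ y ∷ p) c = x + √ ((x * x + y) * c ⁻¹) ∷ secantRoot p c

      SecantCondition-secantRoot : ∀ {v c} (x : Point F v) → c ≢ 0# → SecantCondition x (secantRoot x c) c
      SecantCondition-secantRoot {zero}      []          c≢0 = tt
      SecantCondition-secantRoot {suc v} {c} (x ∷ y ∷ p) c≢0 = cond , SecantCondition-secantRoot p c≢0
        where
        s = √ ((x * x + y) * c ⁻¹)
        cond : c * ((x + s + x) * (x + s + x)) ≡ x * x + y
        cond = begin
          c * ((x + s + x) * (x + s + x))  ≡⟨ cong (λ z → c * (z * z)) (trans (cong (_+ x) (+-comm x s)) (a+b+b≡a s x)) ⟩
          c * (s * s)                      ≡⟨ cong (c *_) (√-square _) ⟩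
          c * ((x * x + y) * c ⁻¹)         ≡⟨ *-⁻¹-cancelˡ _ c≢0 ⟩
          x * x + y                        ∎

      SecantCondition⇒secantRoot : ∀ {v c} (x : Point F v) (a : Vec Carrier v) → c ≢ 0# →
        SecantCondition x a c → a ≡ secantRoot x c
      SecantCondition⇒secantRoot {zero}      []          []       _   _              = refl
      SecantCondition⇒secantRoot {suc v} {c} (x ∷ y ∷ p) (a ∷ as) c≢0 (cond , conds) =
        cong₂ _∷_ coordinate (SecantCondition⇒secantRoot p as c≢0 conds)
        where
        s = √ ((x * x + y) * c ⁻¹)
        coordinate : a ≡ x + s
        coordinate = begin
          a          ≡⟨ sym (a+b+b≡a a x) ⟩
          a + x + x  ≡⟨ cong (_+ x) (square-injective (trans (*-⁻¹-solve c≢0 cond) (sym (√-square _)))) ⟩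
          s + x      ≡⟨ +-comm s x ⟩
          x + s      ∎

      inversion-transversal : Σ (Transversal Nontrivial _⁻¹) λ T → q ℕ.∸ 2 ≡ 2 ℕ.* length (Transversal.reps T)
      inversion-transversal = involution-transversal _≟_ ⁻¹-FixedPointFreeInvolution (Nontrivial-count F-size)

      module _ {v} (x : Point F v) (x∉K : InA F x) where

        open Transversal (proj₁ inversion-transversal)
        open import Data.List.Membership.DecPropositional _≟_ using (_∈?_)

        direction : Vec Carrier v → Point F v
        direction a = embedK F a ⊕ x

        -- As -1 = 1, direction a = embedK a - x, and Secant a c says that the point with parameter c on
        -- the line from x through embedK a is a point embedK b of K.
        Secant : Vec Carrier v → Carrier → Set
        Secant a c = ∃ λ b → direction b ≡ c ⊙ direction a

        direction≢0 : ∀ a → direction a ≢ 0ᵥ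
        direction≢0 a dir≡0 = x∉K (a , trans (sym (⊕-identityʳ x)) (u≡z⊕x⇒x⊕u≡z (sym dir≡0)))

        Secant⇔InK : ∀ {a c} → Secant a c ⇔ InK F (x ⊕ c ⊙ direction a)
        Secant⇔InK = mk⇔ (λ (b , dir-b) → b , u≡z⊕x⇒x⊕u≡z (sym dir-b))
                         (λ (b , on) → b , sym (x⊕u≡z⇒u≡z⊕x on))

        Secant? : ∀ a c → Dec (Secant a c)
        Secant? a c = Dec.map′ (from Secant⇔InK) (to Secant⇔InK) (InK? _)

        Secant⇒SecantCondition : ∀ {a c} → Nontrivial c → Secant a c → SecantCondition x a c
        Secant⇒SecantCondition {a} (_ , c≢1) =
          to (secant⇔SecantCondition x a c≢1) ∘ InK⇒OnParabolas _ ∘ to Secant⇔InK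

        SecantCondition⇒Secant : ∀ {a c} → Nontrivial c → SecantCondition x a c → Secant a c
        SecantCondition⇒Secant {a} (_ , c≢1) =
          from Secant⇔InK ∘ OnParabolas⇒InK _ ∘ from (secant⇔SecantCondition x a c≢1)

        Secant-secantRoot : ∀ {c} → Nontrivial c → Secant (secantRoot x c) c
        Secant-secantRoot c-nt@(c≢0 , _) = SecantCondition⇒Secant c-nt (SecantCondition-secantRoot x c≢0)

        Secant⇒secantRoot : ∀ {a c} → Nontrivial c → Secant a c → a ≡ secantRoot x c
        Secant⇒secantRoot {a} c-nt@(c≢0 , _) = SecantCondition⇒secantRoot x a c≢0 ∘ Secant⇒SecantCondition c-nt

        Secant-unique : ∀ {a c c′} → Nontrivial c → Nontrivial c′ → Secant a c → Secant a c′ → c ≡ c′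
        Secant-unique {a} {c} {c′} c-nt c′-nt sec sec′ with c ≟ c′
        ... | yes c≡c′ = c≡c′
        ... | no  c≢c′ = ⊥-elim (x∉K (OnParabolas⇒InK x
          (SecantCondition-unique x a (Secant⇒SecantCondition c-nt sec) (Secant⇒SecantCondition c′-nt sec′) c≢c′)))

        Secant-inverse : ∀ {a b c} → c ≢ 0# → direction b ≡ c ⊙ direction a → Secant b (c ⁻¹)
        Secant-inverse {a} c≢0 dir-b = a , ⊙-inverse c≢0 dir-b

        Secant-count : ∀ {Q : Pred Carrier 0ℓ} {k} → (∀ {c} → Q c → Nontrivial c) → HasSize Q k →
          HasSize (λ a → ∃ λ c → Q c × Secant a c) k
        Secant-count Q⇒nt = HasSize-map (secantRoot x)
          (λ qc qc′ same → Secant-unique (Q⇒nt qc) (Q⇒nt qc′) (Secant-secantRoot (Q⇒nt qc))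
                                         (subst (λ a → Secant a _) (sym same) (Secant-secantRoot (Q⇒nt qc′))))
          (λ {c} qc → c , qc , Secant-secantRoot (Q⇒nt qc))
          (λ (c , qc , sec) → c , qc , sym (Secant⇒secantRoot (Q⇒nt qc) sec))

        -- reps contains one parameter of each pair {c, c⁻¹}, so of the two points of K on a line through
        -- x meeting K twice, exactly one is a representative.
        Representative : Vec Carrier v → Set
        Representative a = ∀ {c} → Nontrivial c → Secant a c → c ∈ reps

        Unrepresentative : Vec Carrier v → Set
        Unrepresentative a = ∃ λ c → (Nontrivial c × c ∉ reps) × Secant a c

        Unrepresentative? : ∀ a → Dec (Unrepresentative a)
        Unrepresentative? a =
          finite-∃? F-size (λ c → (Nontrivial? c Dec.×-dec Dec.¬? (c ∈? reps)) Dec.×-dec Secant? a c)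

        ¬Unrepresentative⇒Representative : ∀ {a} → ¬ Unrepresentative a → Representative a
        ¬Unrepresentative⇒Representative ¬unrep {c} c-nt sec with c ∈? reps
        ... | yes c∈reps = c∈reps
        ... | no  c∉reps = ⊥-elim (¬unrep (c , (c-nt , c∉reps) , sec))

        Representative-count : HasSize Representative (q ℕ.^ v ℕ.∸ length reps)
        Representative-count = HasSize-cong {Q = Representative}
          ((λ (_ , ¬unrep) → ¬Unrepresentative⇒Representative ¬unrep) ,
           (λ rep → tt , λ (c , (c-nt , c∉reps) , sec) → c∉reps (rep c-nt sec)))
          (HasSize-∖ Unrepresentative? (HasSize-Vec F-size v) (HasSize-cong ((tt ,_) , proj₂) unrepresentative-count))
          where
          non-reps-count : HasSize (Nontrivial ∖ (_∈ reps)) (length reps)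
          non-reps-count = subst (HasSize _) (trans (cong (ℕ._∸ length reps) (proj₂ inversion-transversal)) (2*n∸n≡n _))
            (HasSize-∖ (_∈? reps) (Nontrivial-count F-size)
              (HasSize-cong ((λ c∈ → reps⊆P c∈ , c∈) , proj₂) (HasSize-∈ reps-unique)))
          unrepresentative-count : HasSize Unrepresentative (length reps)
          unrepresentative-count = Secant-count proj₁ non-reps-count

        MeetsK : Point F v → Set
        MeetsK d = ∃ λ t → InK F (x ⊕ t ⊙ d)

        line : Vec Carrier v → Point F v
        line a = normalize (direction a)

        line-MeetsK : ∀ a → Normalized F (line a) × MeetsK (line a)
        line-MeetsK a with l , _ , dir≡ln ← normalize-scale (direction a) (direction≢0 a) =
          normalize-Normalized (direction a) (direction≢0 a) , l , a , u≡z⊕x⇒x⊕u≡z (sym dir≡ln)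

        MeetsK⇒line : ∀ {d} → Normalized F d → MeetsK d → ∃ λ a → line a ≡ d
        MeetsK⇒line {d} d-normalized (t , a , on) = a , (begin
          normalize (direction a)  ≡⟨ cong normalize (sym (x⊕u≡z⇒u≡z⊕x on)) ⟩
          normalize (t ⊙ d)        ≡⟨ normalize-⊙-Normalized d-normalized t≢0 ⟩
          d                        ∎)
          where
          t≢0 : t ≢ 0#
          t≢0 refl = x∉K (a , trans (sym (⊕-identityʳ x)) (trans (cong (x ⊕_) (sym (⊙-zeroˡ d))) on))

        same-line-Representative : ∀ a → ∃ λ b → Representative b × line b ≡ line a
        same-line-Representative a with Unrepresentative? a
        ... | no ¬unrep = a , ¬Unrepresentative⇒Representative ¬unrep , refl
        ... | yes (c , (c-nt@(c≢0 , _) , c∉reps) , b , dir-b) = b , b-rep , b-line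
          where
          c⁻¹∈reps : c ⁻¹ ∈ reps
          c⁻¹∈reps with covers c-nt
          ... | inj₁ c∈reps   = ⊥-elim (c∉reps c∈reps)
          ... | inj₂ c⁻¹∈reps = c⁻¹∈reps
          b-rep : Representative b
          b-rep c′-nt sec′ = subst (_∈ reps)
            (Secant-unique (proj₁ (⁻¹-FixedPointFreeInvolution c-nt)) c′-nt (Secant-inverse c≢0 dir-b) sec′) c⁻¹∈reps
          b-line : line b ≡ line a
          b-line = trans (cong normalize dir-b) (normalize-⊙ (direction a) c≢0 (direction≢0 a))

        line-injective : ∀ {a a′} → Representative a → Representative a′ → line a ≡ line a′ → a ≡ a′
        line-injective {a} {a′} a-rep a′-rep same
          with c , c≢0 , dir-a′ ← normalize-≡⇒proportional (direction≢0 a) (direction≢0 a′) same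
          with c ≟ 1#
        ... | yes refl = embedK-injective a a′
          (⊕-cancelʳ (embedK F a) (embedK F a′) x (sym (trans dir-a′ (⊙-identityˡ (direction a)))))
        ... | no c≢1 = ⊥-elim (separates (a-rep (c≢0 , c≢1) (a′ , dir-a′))
          (a′-rep (proj₁ (⁻¹-FixedPointFreeInvolution (c≢0 , c≢1))) (Secant-inverse c≢0 dir-a′)))

        MeetsK-count : HasSize (Normalized F ∩ MeetsK) (q ℕ.^ v ℕ.∸ length reps)
        MeetsK-count = HasSize-map line line-injective (λ {a} _ → line-MeetsK a)
          (λ (d-normalized , meets) →
            let a , line-a = MeetsK⇒line d-normalized meets
                b , b-rep , line-b = same-line-Representative a
            in b , b-rep , trans line-b line-a)
          Representative-count

        LineInA-count : HasSize (λ d → Normalized F d × LineInA F x d)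
                                (geometricSum q (dbl v) ℕ.∸ (q ℕ.^ v ℕ.∸ (q ℕ.∸ 2) ℕ./ 2))
        LineInA-count = subst (λ h → HasSize _ (geometricSum q (dbl v) ℕ.∸ (q ℕ.^ v ℕ.∸ h)))
          (sym (trans (cong (ℕ._/ 2) (proj₂ inversion-transversal)) (2*n/2≡n (length reps))))
          (HasSize-cong ((λ (d-normalized , misses) → d-normalized , λ t on → misses (t , on)) ,
                         (λ (d-normalized , in-A) → d-normalized , λ (t , on) → in-A t on))
            (HasSize-∖ (λ d → finite-∃? F-size (λ t → InK? (x ⊕ t ⊙ d))) (Normalized-count F-size (dbl v)) MeetsK-count))


open import Data.Nat using (_≤_; _∸_; _^_; _+_; _/_)

proposition12 : (F : Field) (q m v : ℕ) → 1 ≤ m → q ≡ 2 ^ m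
    → HasSize (λ (_ : Field.Carrier F) → ⊤) q → 1 ≤ v
    → (x : Point F v) → InA F x
    → HasSize (λ d → Normalized F d × LineInA F x d) (B q v ∸ q ^ v + (q ∸ 2) / 2)
proposition12 F q (suc m) (suc v) _ q≡2^[1+m] F-size _ x x∉K
  with j , 2^[1+m]≡2+2j ← 2^[1+m]≡2+2*j m
  with refl ← trans q≡2^[1+m] 2^[1+m]≡2+2j =
  subst (HasSize _) (lines-formula j v) (LineInA-count F char2 F-size x x∉K)
  where
  char2 : Field._+_ F (Field.1# F) (Field.1# F) ≡ Field.0# F
  char2 = odd-units⇒char2 F {k = j} (units-count F F-size)
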